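{- For an integer $k\geq 4$, let $F_k$ be the graph with vertex set $\{v_1,\dots,v_k\}\cup\{w_1,\dots,w_k\}\cup\{w_1',\dots,w_k'\}$ (all distinct) whose edges are all pairs $v_iv_j$ with $i\neq j$ together with the edges $v_iw_i$, $w_iw_i'$, $w_i'v_{i+1}$ for $1\leq i\leq k$, where the index $i+1$ is taken modulo $k$. Then $\gamma_{t[1,2]}(F_k)=\frac{2n}{3}$, where $n=3k$ is the order of $F_k$.
   Context: All graphs are finite, simple and undirected; $N(v)$ denotes the neighborhood of $v$. A set $S\subseteq V(G)$ is a total $[1,2]$-set of $G$ if $1\leq |N(v)\cap S|\leq 2$ for every vertex $v\in V(G)$. $\gamma_{t[1,2]}(G)$ is the minimum cardinality of a total $[1,2]$-set of $G$, with $\gamma_{t[1,2]}(G)=+\infty$ if no such set exists. -}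

module Defs where

open import Data.Nat using (ℕ; zero; suc; _≤_; _*_)
open import Data.Nat.Properties using () renaming (_≟_ to _≟ℕ_)
open import Data.Fin using (Fin; zero; suc; toℕ; remQuot)
open import Data.Fin.Subset using (Subset; _∩_; ∣_∣)
open import Data.Vec using (tabulate)
open import Data.Bool using (Bool; true; false; _∨_; _∧_; not)
open import Data.Product using (_×_; _,_; ∃)
open import Relation.Nullary.Decidable using (⌊_⌋)
open import Relation.Binary.PropositionalEquality using (_≡_)

-- A finite simple graph on vertex set Fin n is given by a Boolean adjacency
-- function (symmetric, irreflexive for the graphs we use).
Adj : ℕ → Set
Adj n = Fin n → Fin n → Bool

N : ∀ {n} → Adj n → Fin n → Subset n
N adj v = tabulate (λ u → adj v u)

IsTotal12Set : ∀ {n} → Adj n → Subset n → Set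
IsTotal12Set adj S = ∀ v → (1 ≤ ∣ N adj v ∩ S ∣) × (∣ N adj v ∩ S ∣ ≤ 2)

γt12≡ : ∀ {n} → Adj n → ℕ → Set
γt12≡ {n} adj m =
  (∃ λ (S : Subset n) → IsTotal12Set adj S × ∣ S ∣ ≡ m)
  × (∀ (S : Subset n) → IsTotal12Set adj S → m ≤ ∣ S ∣)

-- The graph F_k.  Vertex x : Fin (3 * k) decodes via remQuot k to (t , i):
-- t = 0 : v_i,  t = 1 : w_i,  t = 2 : w'_i   (indices i ∈ Fin k, 0-based).
eqF : ∀ {k} → Fin k → Fin k → Bool
eqF i j = ⌊ toℕ i ≟ℕ toℕ j ⌋

isNext : (k : ℕ) → Fin k → Fin k → Bool
isNext k i j = ⌊ suc (toℕ i) ≟ℕ toℕ j ⌋ ∨ (⌊ suc (toℕ i) ≟ℕ k ⌋ ∧ ⌊ toℕ j ≟ℕ 0 ⌋)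

edgeD : (k : ℕ) → Fin 3 × Fin k → Fin 3 × Fin k → Bool
edgeD k (zero , i)           (zero , j)           = not (eqF i j)
edgeD k (zero , i)           (suc zero , j)       = eqF i j
edgeD k (suc zero , i)       (suc (suc zero) , j) = eqF i j
edgeD k (suc (suc zero) , i) (zero , j)           = isNext k i j
edgeD k _ _ = false

F : (k : ℕ) → Adj (3 * k)
F k x y = edgeD k (remQuot k x) (remQuot k y) ∨ edgeD k (remQuot k y) (remQuot k x)

module Submission where

-- The 2k vertices w_i, w'_i form a total [1,2]-set: v_i sees exactly w_i and w'_{i-1} of them,
-- and w_i, w'_i see each other. Conversely, let S be any total [1,2]-set. Since N(w_i) = {v_i, w'_i}
-- and N(w'_i) = {w_i, v_{i+1}}, S contains v_i or w'_i, and w_i or v_{i+1}. If v_i were in S, then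
-- v_{i+2} would have three neighbours in S: v_i, one of v_{i+1}, w'_{i+1}, and one of w_{i+2}, v_{i+3},
-- pairwise distinct because k ≥ 4. So S misses the clique and therefore contains every w_i and w'_i.

open import Defs
open import Data.Nat using (ℕ; suc; _+_; _*_; _∸_; _≤_; _<_; z≤n; s≤s; NonZero; >-nonZero; >-nonZero⁻¹)
open import Data.Nat.Properties
  using (≤-trans; ≤-refl; ≤-reflexive; +-mono-≤; +-suc; <⇒≢; <⇒≤; ≤⇒≯; ≤∧≢⇒<; +-comm; +-assoc; m∸n+n≡m;
         module ≤-Reasoning)
  renaming (_≟_ to _≟ℕ_)
open import Data.Nat.DivMod
  using (_%_; _mod_; %-distribˡ-+; m%n%n≡m%n; %-remove-+ˡ; m<n⇒m%n≡m; %-congˡ; n%n≡0)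
open import Data.Nat.Divisibility using (∣-refl)
open import Data.Fin using (Fin; zero; suc; toℕ; combine; remQuot)
open import Data.Fin.Subset renaming (⊥ to ∅)
open import Data.Fin.Subset.Properties
open import Data.Fin.Properties
  using (toℕ-injective; toℕ<n; toℕ-fromℕ<; remQuot-combine; combine-remQuot)
open import Data.Vec using (Vec; []; _∷_; _++_; concat; lookup)
open import Data.Vec.Properties using (lookup∘tabulate; []=⇒lookup; lookup⇒[]=; lookup-concat)
open import Data.Bool using (T; not; _∨_; _∧_)
open import Data.Bool.Properties using (T-≡; T-∨)
open import Data.Product using (_×_; _,_; ∃; proj₁; proj₂; uncurry)
open import Data.Empty using (⊥; ⊥-elim)
open import Data.Sum using (_⊎_; inj₁; inj₂)
open import Function using (_∘_; _⇔_; mk⇔; Equivalence)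
open import Relation.Nullary using (yes; no; contradiction)
open import Relation.Nullary.Decidable using (⌊_⌋; toWitness; fromWitness; fromWitnessFalse)
open import Relation.Binary.PropositionalEquality

∣p∪q∣≤∣p∣+∣q∣ : ∀ {n} (p q : Subset n) → ∣ p ∪ q ∣ ≤ ∣ p ∣ + ∣ q ∣
∣p∪q∣≤∣p∣+∣q∣ []            []            = z≤n
∣p∪q∣≤∣p∣+∣q∣ (inside  ∷ p) (s ∷ q)       =
  s≤s (≤-trans (∣p∪q∣≤∣p∣+∣q∣ p q) (+-mono-≤ (≤-refl {∣ p ∣}) (∣p∣≤∣x∷p∣ s q)))
∣p∪q∣≤∣p∣+∣q∣ (outside ∷ p) (inside  ∷ q) =
  ≤-trans (s≤s (∣p∪q∣≤∣p∣+∣q∣ p q)) (≤-reflexive (sym (+-suc ∣ p ∣ ∣ q ∣)))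
∣p∪q∣≤∣p∣+∣q∣ (outside ∷ p) (outside ∷ q) = ∣p∪q∣≤∣p∣+∣q∣ p q

∣p++q∣≡∣p∣+∣q∣ : ∀ {m n} (p : Subset m) (q : Subset n) → ∣ p ++ q ∣ ≡ ∣ p ∣ + ∣ q ∣
∣p++q∣≡∣p∣+∣q∣ []            q = refl
∣p++q∣≡∣p∣+∣q∣ (inside  ∷ p) q = cong suc (∣p++q∣≡∣p∣+∣q∣ p q)
∣p++q∣≡∣p∣+∣q∣ (outside ∷ p) q = ∣p++q∣≡∣p∣+∣q∣ p q

x∈p⇒0<∣p∣ : ∀ {n} {p : Subset n} {x} → x ∈ p → 0 < ∣ p ∣
x∈p⇒0<∣p∣ x∈p = ≤-trans (s≤s z≤n) (x∈p⇒∣p-x∣<∣p∣ x∈p)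

0<∣p∣⇒Nonempty : ∀ {n} {p : Subset n} → 0 < ∣ p ∣ → Nonempty p
0<∣p∣⇒Nonempty {n} {p} 0<∣p∣ with nonempty? p
... | yes p≢∅ = p≢∅
... | no  p≡∅ = contradiction (trans (cong ∣_∣ (Empty-unique p≡∅)) (∣⊥∣≡0 n)) (<⇒≢ 0<∣p∣ ∘ sym)

⊆⁅x⁆∪⁅y⁆⇒∣p∣≤2 : ∀ {n} {p : Subset n} {x y} → (∀ {z} → z ∈ p → z ≡ x ⊎ z ≡ y) → ∣ p ∣ ≤ 2
⊆⁅x⁆∪⁅y⁆⇒∣p∣≤2 {p = p} {x} {y} p⊆ = begin
  ∣ p ∣                   ≤⟨ p⊆q⇒∣p∣≤∣q∣ sub ⟩
  ∣ ⁅ x ⁆ ∪ ⁅ y ⁆ ∣       ≤⟨ ∣p∪q∣≤∣p∣+∣q∣ ⁅ x ⁆ ⁅ y ⁆ ⟩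
  ∣ ⁅ x ⁆ ∣ + ∣ ⁅ y ⁆ ∣   ≡⟨ cong₂ _+_ (∣⁅x⁆∣≡1 x) (∣⁅x⁆∣≡1 y) ⟩
  2                       ∎
  where
  open ≤-Reasoning
  sub : p ⊆ ⁅ x ⁆ ∪ ⁅ y ⁆
  sub z∈p with p⊆ z∈p
  ... | inj₁ refl = x∈p∪q⁺ (inj₁ (x∈⁅x⁆ x))
  ... | inj₂ refl = x∈p∪q⁺ (inj₂ (x∈⁅x⁆ y))

3≤∣p∣ : ∀ {n} {p : Subset n} {x y z} → x ∈ p → y ∈ p → z ∈ p → x ≢ y → x ≢ z → y ≢ z → 3 ≤ ∣ p ∣
3≤∣p∣ {p = p} {x} {y} {z} x∈p y∈p z∈p x≢y x≢z y≢z =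
  begin
    3                   ≤⟨ s≤s (s≤s (x∈p⇒0<∣p∣ z∈p-x-y)) ⟩
    2 + ∣ p - x - y ∣   ≤⟨ s≤s (x∈p⇒∣p-x∣<∣p∣ y∈p-x) ⟩
    1 + ∣ p - x ∣       ≤⟨ x∈p⇒∣p-x∣<∣p∣ x∈p ⟩
    ∣ p ∣               ∎
  where
  open ≤-Reasoning
  y∈p-x = x∈p∧x≢y⇒x∈p-y y∈p (x≢y ∘ sym)
  z∈p-x-y = x∈p∧x≢y⇒x∈p-y (x∈p∧x≢y⇒x∈p-y z∈p (x≢z ∘ sym)) (y≢z ∘ sym)

[m+n%d]%d≡[m+n]%d : ∀ m n d .{{_ : NonZero d}} → (m + n % d) % d ≡ (m + n) % d
[m+n%d]%d≡[m+n]%d m n d = begin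
  (m + n % d) % d         ≡⟨ %-distribˡ-+ m (n % d) d ⟩
  (m % d + n % d % d) % d ≡⟨ cong (λ r → (m % d + r) % d) (m%n%n≡m%n n d) ⟩
  (m % d + n % d) % d     ≡⟨ %-distribˡ-+ m n d ⟨
  (m + n) % d             ∎
  where open ≡-Reasoning

[m+a]%d≡[n+a]%d⇒m≡n : ∀ {m n a d} .{{_ : NonZero d}} → m < d → n < d → a ≤ d →
                      (m + a) % d ≡ (n + a) % d → m ≡ n
[m+a]%d≡[n+a]%d⇒m≡n {m} {n} {a} {d} m<d n<d a≤d eq = begin
  m                             ≡⟨ unshift m<d ⟨
  (d ∸ a + (m + a) % d) % d     ≡⟨ cong (λ r → (d ∸ a + r) % d) eq ⟩
  (d ∸ a + (n + a) % d) % d     ≡⟨ unshift n<d ⟩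
  n                             ∎
  where
  open ≡-Reasoning
  unshift : ∀ {x} → x < d → (d ∸ a + (x + a) % d) % d ≡ x
  unshift {x} x<d = begin
    (d ∸ a + (x + a) % d) % d   ≡⟨ [m+n%d]%d≡[m+n]%d (d ∸ a) (x + a) d ⟩
    (d ∸ a + (x + a)) % d       ≡⟨ cong (λ r → (d ∸ a + r) % d) (+-comm x a) ⟩
    (d ∸ a + (a + x)) % d       ≡⟨ cong (_% d) (+-assoc (d ∸ a) a x) ⟨
    (d ∸ a + a + x) % d         ≡⟨ cong (λ r → (r + x) % d) (m∸n+n≡m a≤d) ⟩
    (d + x) % d                 ≡⟨ %-remove-+ˡ x (∣-refl {d}) ⟩
    x % d                       ≡⟨ m<n⇒m%n≡m x<d ⟩
    x                           ∎

sucMod⇔ : ∀ {a b d} .{{_ : NonZero d}} → a < d → b < d →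
          T (⌊ suc a ≟ℕ b ⌋ ∨ (⌊ suc a ≟ℕ d ⌋ ∧ ⌊ b ≟ℕ 0 ⌋)) ⇔ b ≡ suc a % d
sucMod⇔ {a} {b} {d} a<d b<d with suc a ≟ℕ b | suc a ≟ℕ d | b ≟ℕ 0
... | yes refl | _        | _        = mk⇔ (λ _ → sym (m<n⇒m%n≡m b<d)) _
... | no _     | yes 1+a≡d | yes refl = mk⇔ (λ _ → sym 1+a%d≡0) _
  where 1+a%d≡0 = trans (%-congˡ 1+a≡d) (n%n≡0 d)
... | no _     | yes 1+a≡d | no b≢0   =
  mk⇔ (λ ()) (λ b≡ → b≢0 (trans b≡ (trans (%-congˡ 1+a≡d) (n%n≡0 d))))
... | no 1+a≢b | no 1+a≢d  | _        =
  mk⇔ (λ ()) (λ b≡ → 1+a≢b (sym (trans b≡ (m<n⇒m%n≡m (≤∧≢⇒< a<d 1+a≢d)))))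

combine∈concat⇔ : ∀ {m n} (ps : Vec (Subset n) m) i j → combine i j ∈ concat ps ⇔ j ∈ lookup ps i
combine∈concat⇔ ps i j = mk⇔
  (λ ij∈ → lookup⇒[]= j _ (trans (sym (lookup-concat ps i j)) ([]=⇒lookup ij∈)))
  (λ j∈ → lookup⇒[]= (combine i j) _ (trans (lookup-concat ps i j) ([]=⇒lookup j∈)))

∈N⇔ : ∀ {n} {adj : Adj n} {v x} → x ∈ N adj v ⇔ T (adj v x)
∈N⇔ {adj = adj} {v} {x} = mk⇔
  (λ x∈ → Equivalence.from T-≡ (trans (sym (lookup∘tabulate (adj v) x)) ([]=⇒lookup x∈)))
  (λ t → lookup⇒[]= x _ (trans (lookup∘tabulate (adj v) x) (Equivalence.to T-≡ t)))

module TotalSets {n} (adj : Adj n) {S : Subset n} where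

  ∈N∩⁺ : ∀ {v x} → T (adj v x) → x ∈ S → x ∈ N adj v ∩ S
  ∈N∩⁺ {v} t x∈S = x∈p∩q⁺ (Equivalence.from (∈N⇔ {adj = adj} {v}) t , x∈S)

  ∈N∩⁻ : ∀ {v x} → x ∈ N adj v ∩ S → T (adj v x) × x ∈ S
  ∈N∩⁻ {v} x∈ with x∈p∩q⁻ _ _ x∈
  ... | x∈N , x∈S = Equivalence.to (∈N⇔ {adj = adj} {v}) x∈N , x∈S

  within[1,2] : ∀ {v y a b} → T (adj v y) → y ∈ S → (∀ {z} → T (adj v z) → z ∈ S → z ≡ a ⊎ z ≡ b) →
                (1 ≤ ∣ N adj v ∩ S ∣) × (∣ N adj v ∩ S ∣ ≤ 2)
  within[1,2] t y∈S N∩S⊆ =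
    x∈p⇒0<∣p∣ (∈N∩⁺ t y∈S) , ⊆⁅x⁆∪⁅y⁆⇒∣p∣≤2 (λ z∈ → let (t , z∈S) = ∈N∩⁻ z∈ in N∩S⊆ t z∈S)

  module _ (S-total : IsTotal12Set adj S) where

    total⇒a∈S⊎b∈S : ∀ {v a b} → (∀ {y} → T (adj v y) → y ≡ a ⊎ y ≡ b) → a ∈ S ⊎ b ∈ S
    total⇒a∈S⊎b∈S {v} N⊆ with 0<∣p∣⇒Nonempty (proj₁ (S-total v))
    ... | y , y∈ with ∈N∩⁻ y∈
    ... | t , y∈S with N⊆ t
    ...   | inj₁ refl = inj₁ y∈S
    ...   | inj₂ refl = inj₂ y∈S

    no-three-neighbours : ∀ {v x y z} → x ∈ N adj v ∩ S → y ∈ N adj v ∩ S → z ∈ N adj v ∩ S →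
                          x ≢ y → x ≢ z → y ≢ z → ⊥
    no-three-neighbours {v} x∈ y∈ z∈ x≢y x≢z y≢z =
      ≤⇒≯ (proj₂ (S-total v)) (3≤∣p∣ x∈ y∈ z∈ x≢y x≢z y≢z)

eqF⇒≡ : ∀ {n} {i j : Fin n} → T (eqF i j) → i ≡ j
eqF⇒≡ = toℕ-injective ∘ toWitness

eqF-refl : ∀ {n} (i : Fin n) → T (eqF i i)
eqF-refl i = fromWitness refl

≢⇒¬eqF : ∀ {n} {i j : Fin n} → i ≢ j → T (not (eqF i j))
≢⇒¬eqF i≢j = fromWitnessFalse (i≢j ∘ toℕ-injective)

module Fₖ (k : ℕ) .{{_ : NonZero k}} where

  open TotalSets (F k)

  shift : ℕ → Fin k → Fin k
  shift m i = (m + toℕ i) mod k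

  toℕ-shift : ∀ m i → toℕ (shift m i) ≡ (m + toℕ i) % k
  toℕ-shift m i = toℕ-fromℕ< _

  shift-zero : ∀ i → shift 0 i ≡ i
  shift-zero i = toℕ-injective (trans (toℕ-shift 0 i) (m<n⇒m%n≡m (toℕ<n i)))

  shift-k : ∀ i → shift k i ≡ i
  shift-k i = toℕ-injective (begin
    toℕ (shift k i)    ≡⟨ toℕ-shift k i ⟩
    (k + toℕ i) % k    ≡⟨ %-remove-+ˡ (toℕ i) (∣-refl {k}) ⟩
    toℕ i % k          ≡⟨ m<n⇒m%n≡m (toℕ<n i) ⟩
    toℕ i              ∎)
    where open ≡-Reasoning

  shift-shift : ∀ m n i → shift m (shift n i) ≡ shift (m + n) i
  shift-shift m n i = toℕ-injective (begin
    toℕ (shift m (shift n i))   ≡⟨ toℕ-shift m _ ⟩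
    (m + toℕ (shift n i)) % k   ≡⟨ cong (λ r → (m + r) % k) (toℕ-shift n i) ⟩
    (m + (n + toℕ i) % k) % k   ≡⟨ [m+n%d]%d≡[m+n]%d m (n + toℕ i) k ⟩
    (m + (n + toℕ i)) % k       ≡⟨ cong (_% k) (+-assoc m n (toℕ i)) ⟨
    (m + n + toℕ i) % k         ≡⟨ toℕ-shift (m + n) i ⟨
    toℕ (shift (m + n) i)       ∎)
    where open ≡-Reasoning

  shift-injectiveˡ : ∀ {m n} i → m < k → n < k → shift m i ≡ shift n i → m ≡ n
  shift-injectiveˡ {m} {n} i m<k n<k eq = [m+a]%d≡[n+a]%d⇒m≡n m<k n<k (<⇒≤ (toℕ<n i))
    (trans (sym (toℕ-shift m i)) (trans (cong toℕ eq) (toℕ-shift n i)))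

  next prev : Fin k → Fin k
  next = shift 1
  prev = shift (k ∸ 1)

  prev-next : ∀ i → prev (next i) ≡ i
  prev-next i = trans (shift-shift (k ∸ 1) 1 i)
    (trans (cong (λ m → shift m i) (m∸n+n≡m (>-nonZero⁻¹ k))) (shift-k i))

  isNext⇔ : ∀ {i j} → T (isNext k i j) ⇔ j ≡ next i
  isNext⇔ {i} {j} = mk⇔
    (λ t → toℕ-injective (trans (Equivalence.to succ t) (sym (toℕ-shift 1 i))))
    (λ j≡ → Equivalence.from succ (trans (cong toℕ j≡) (toℕ-shift 1 i)))
    where succ = sucMod⇔ (toℕ<n i) (toℕ<n j)

  V W W' : Fin k → Fin (3 * k)
  V  = combine {3} zero
  W  = combine {3} (suc zero)
  W' = combine {3} (suc (suc zero))

  data Vertex : Fin (3 * k) → Set where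
    v  : ∀ i → Vertex (V i)
    w  : ∀ i → Vertex (W i)
    w' : ∀ i → Vertex (W' i)

  vertex : ∀ x → Vertex x
  vertex x = subst Vertex (combine-remQuot {3} k x) (classify (remQuot {3} k x))
    where
    classify : (p : Fin 3 × Fin k) → Vertex (uncurry combine p)
    classify (zero , i)             = v i
    classify (suc zero , i)         = w i
    classify (suc (suc zero) , i)   = w' i

  index : Fin (3 * k) → Fin k
  index x = proj₂ (remQuot {3} k x)

  index-combine : ∀ t i → index (combine t i) ≡ i
  index-combine t i = cong proj₂ (remQuot-combine {3} {k} t i)

  F-combine : ∀ s i t j →
              F k (combine s i) (combine t j) ≡ edgeD k (s , i) (t , j) ∨ edgeD k (t , j) (s , i)
  F-combine s i t j rewrite remQuot-combine {3} {k} s i | remQuot-combine {3} {k} t j = refl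

  edge⁺ : ∀ s t {i j} → T (edgeD k (s , i) (t , j) ∨ edgeD k (t , j) (s , i)) →
          T (F k (combine s i) (combine t j))
  edge⁺ s t {i} {j} = subst T (sym (F-combine s i t j))

  edge⁻ : ∀ s t {i j} → T (F k (combine s i) (combine t j)) →
          T (edgeD k (s , i) (t , j) ∨ edgeD k (t , j) (s , i))
  edge⁻ s t {i} {j} = subst T (F-combine s i t j)

  V~V : ∀ {i j} → i ≢ j → T (F k (V i) (V j))
  V~V i≢j = edge⁺ zero zero (Equivalence.from T-∨ (inj₁ (≢⇒¬eqF i≢j)))

  V~W : ∀ i → T (F k (V i) (W i))
  V~W i = edge⁺ zero (suc zero) (Equivalence.from T-∨ (inj₁ (eqF-refl i)))

  W~W' : ∀ i → T (F k (W i) (W' i))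
  W~W' i = edge⁺ (suc zero) (suc (suc zero)) (Equivalence.from T-∨ (inj₁ (eqF-refl i)))

  W'~W : ∀ i → T (F k (W' i) (W i))
  W'~W i = edge⁺ (suc (suc zero)) (suc zero) (eqF-refl i)

  V~W' : ∀ {i j} → i ≡ next j → T (F k (V i) (W' j))
  V~W' i≡ = edge⁺ zero (suc (suc zero)) (Equivalence.from isNext⇔ i≡)

  N-W : ∀ {i y} → T (F k (W i) y) → y ≡ V i ⊎ y ≡ W' i
  N-W {i} {y} t with vertex y
  ... | v j  = inj₁ (cong V (eqF⇒≡ (edge⁻ (suc zero) zero t)))
  ... | w j  = ⊥-elim (edge⁻ (suc zero) (suc zero) t)
  ... | w' j with Equivalence.to T-∨ (edge⁻ (suc zero) (suc (suc zero)) t)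
  ...   | inj₁ i≡j = inj₂ (cong W' (sym (eqF⇒≡ i≡j)))

  N-W' : ∀ {i y} → T (F k (W' i) y) → y ≡ W i ⊎ y ≡ V (next i)
  N-W' {i} {y} t with vertex y
  ... | w' j = ⊥-elim (edge⁻ (suc (suc zero)) (suc (suc zero)) t)
  ... | w j  = inj₁ (cong W (eqF⇒≡ (edge⁻ (suc (suc zero)) (suc zero) t)))
  ... | v j with Equivalence.to T-∨ (edge⁻ (suc (suc zero)) zero t)
  ...   | inj₁ j-next = inj₂ (cong V (Equivalence.to isNext⇔ j-next))

  -- Fin (3 * k) is laid out as the blocks v, w, w' (see remQuot), so outer = {w_i, w'_i}.
  blocks : Vec (Subset k) 3
  blocks = ∅ ∷ ⊤ ∷ ⊤ ∷ []

  outer : Subset (3 * k)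
  outer = concat blocks

  V∉outer : ∀ i → V i ∉ outer
  V∉outer i = ∉⊥ ∘ Equivalence.to (combine∈concat⇔ blocks zero i)

  W∈outer : ∀ i → W i ∈ outer
  W∈outer i = Equivalence.from (combine∈concat⇔ blocks (suc zero) i) ∈⊤

  W'∈outer : ∀ i → W' i ∈ outer
  W'∈outer i = Equivalence.from (combine∈concat⇔ blocks (suc (suc zero)) i) ∈⊤

  ∣outer∣≡2k : ∣ outer ∣ ≡ 2 * k
  ∣outer∣≡2k = begin
    ∣ ∅ {k} ++ ⊤ {k} ++ ⊤ {k} ++ [] ∣      ≡⟨ ∣p++q∣≡∣p∣+∣q∣ (∅ {k}) (⊤ {k} ++ ⊤ {k} ++ []) ⟩
    ∣ ∅ {k} ∣ + ∣ ⊤ {k} ++ ⊤ {k} ++ [] ∣   ≡⟨ cong (_+ ∣ ⊤ {k} ++ ⊤ {k} ++ [] ∣) (∣⊥∣≡0 k) ⟩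
    ∣ ⊤ {k} ++ ⊤ {k} ++ [] ∣               ≡⟨ ∣p++q∣≡∣p∣+∣q∣ (⊤ {k}) (⊤ {k} ++ []) ⟩
    ∣ ⊤ {k} ∣ + ∣ ⊤ {k} ++ [] ∣            ≡⟨ cong₂ _+_ (∣⊤∣≡n k) (∣p++q∣≡∣p∣+∣q∣ (⊤ {k}) []) ⟩
    k + (∣ ⊤ {k} ∣ + 0)                    ≡⟨ cong (λ m → k + (m + 0)) (∣⊤∣≡n k) ⟩
    2 * k                                  ∎
    where open ≡-Reasoning

  N-V∩outer : ∀ {i y} → T (F k (V i) y) → y ∈ outer → y ≡ W i ⊎ y ≡ W' (prev i)
  N-V∩outer {i} {y} t y∈outer with vertex y
  ... | v j  = contradiction y∈outer (V∉outer j)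
  ... | w j with Equivalence.to T-∨ (edge⁻ zero (suc zero) t)
  ...   | inj₁ i=j = inj₁ (cong W (sym (eqF⇒≡ i=j)))
  N-V∩outer {i} t y∈outer | w' j
    = inj₂ (cong W' (sym (trans (cong prev i≡next-j) (prev-next j))))
    where i≡next-j = Equivalence.to isNext⇔ (edge⁻ zero (suc (suc zero)) t)

  outer-total : IsTotal12Set (F k) outer
  outer-total x with vertex x
  ... | v i  = within[1,2] (V~W i) (W∈outer i) N-V∩outer
  ... | w i  = within[1,2] (W~W' i) (W'∈outer i) (λ t _ → N-W t)
  ... | w' i = within[1,2] (W'~W i) (W∈outer i) (λ t _ → N-W' t)

  next-no-short-cycles : 3 < k → ∀ i → i ≢ next i × i ≢ next (next i) × i ≢ next (next (next i))
  next-no-short-cycles 3<k i =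
      apart (s≤s z≤n) (λ ()) refl
    , apart (s≤s (s≤s z≤n)) (λ ()) (shift-shift 1 1 i)
    , apart (s≤s (s≤s (s≤s z≤n))) (λ ())
            (trans (cong next (shift-shift 1 1 i)) (shift-shift 1 2 i))
    where
    apart : ∀ {m j} → m ≤ 3 → 0 ≢ m → j ≡ shift m i → i ≢ j
    apart m≤3 0≢m j≡ i≡j = 0≢m (shift-injectiveˡ i (≤-trans (s≤s z≤n) 3<k) (≤-trans (s≤s m≤3) 3<k)
                                  (trans (shift-zero i) (trans i≡j j≡)))

  index-apart : ∀ {x y a b} → index x ≡ a → index y ≡ b → a ≢ b → x ≢ y
  index-apart idx idy a≢b x≡y = a≢b (trans (sym idx) (trans (cong index x≡y) idy))

  index-apart-⊎ : ∀ {x y a b c} → index x ≡ a → index y ≡ b ⊎ index y ≡ c → a ≢ b → a ≢ c → x ≢ y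
  index-apart-⊎ idx (inj₁ idy) a≢b _   = index-apart idx idy a≢b
  index-apart-⊎ idx (inj₂ idy) _   a≢c = index-apart idx idy a≢c

  module _ {S : Subset (3 * k)} (S-total : IsTotal12Set (F k) S) where

    W-cover : ∀ i → V i ∈ S ⊎ W' i ∈ S
    W-cover i = total⇒a∈S⊎b∈S S-total (N-W {i})

    W'-cover : ∀ i → W i ∈ S ⊎ V (next i) ∈ S
    W'-cover i = total⇒a∈S⊎b∈S S-total (N-W' {i})

    V∉S : 3 < k → ∀ i → V i ∉ S
    V∉S 3<k i Vi∈S =
      let (x₂ , x₂∈ , idx₂) = before
          (x₃ , x₃∈ , idx₃) = after
      in no-three-neighbours S-total (∈N∩⁺ (V~V (≢-sym i≢l)) Vi∈S) x₂∈ x₃∈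
           (index-apart (index-combine zero i) idx₂ i≢p)
           (index-apart-⊎ (index-combine zero i) idx₃ i≢l i≢q)
           (index-apart-⊎ idx₂ idx₃ p≢l p≢q)
      where
      p = next i
      l = next p
      q = next l
      i≢p = proj₁ (next-no-short-cycles 3<k i)
      i≢l = proj₁ (proj₂ (next-no-short-cycles 3<k i))
      i≢q = proj₂ (proj₂ (next-no-short-cycles 3<k i))
      p≢l = proj₁ (next-no-short-cycles 3<k p)
      p≢q = proj₁ (proj₂ (next-no-short-cycles 3<k p))
      l≢q = proj₁ (next-no-short-cycles 3<k l)
      before : ∃ λ x → x ∈ N (F k) (V l) ∩ S × index x ≡ p
      before with W-cover p
      ... | inj₁ Vp∈S  = V p , ∈N∩⁺ (V~V (≢-sym p≢l)) Vp∈S , index-combine zero p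
      ... | inj₂ W'p∈S = W' p , ∈N∩⁺ (V~W' refl) W'p∈S , index-combine (suc (suc zero)) p
      after : ∃ λ x → x ∈ N (F k) (V l) ∩ S × (index x ≡ l ⊎ index x ≡ q)
      after with W'-cover l
      ... | inj₁ Wl∈S = W l , ∈N∩⁺ (V~W l) Wl∈S , inj₁ (index-combine (suc zero) l)
      ... | inj₂ Vq∈S = V q , ∈N∩⁺ (V~V l≢q) Vq∈S , inj₂ (index-combine zero q)

    outer⊆S : 3 < k → outer ⊆ S
    outer⊆S 3<k {y} y∈outer with vertex y
    ... | v j  = contradiction y∈outer (V∉outer j)
    ... | w j  with W'-cover j
    ...   | inj₁ Wj∈S     = Wj∈S
    ...   | inj₂ Vnext∈S  = contradiction Vnext∈S (V∉S 3<k (next j))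
    outer⊆S 3<k y∈outer | w' j with W-cover j
    ...   | inj₁ Vj∈S     = contradiction Vj∈S (V∉S 3<k j)
    ...   | inj₂ W'j∈S    = W'j∈S

proposition2p6 : ∀ (k : ℕ) → 4 ≤ k → γt12≡ (F k) (2 * k)
proposition2p6 k 4≤k = (outer , outer-total , ∣outer∣≡2k) , λ S S-total →
  subst (_≤ ∣ S ∣) ∣outer∣≡2k (p⊆q⇒∣p∣≤∣q∣ (outer⊆S S-total 4≤k))
  where
  instance
    k≢0 : NonZero k
    k≢0 = >-nonZero (≤-trans (s≤s z≤n) 4≤k)
  open Fₖ k
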